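{- Let $\Gamma_1=({\mathcal V}_1,{\mathcal D}_1)$ and $\Gamma_2=({\mathcal V}_2,{\mathcal D}_2)$ be digraphs without sources and sinks possessing reversals $\sigma_1$ and $\sigma_2$ respectively, let $\Gamma=\mathrm{SBP}(\Gamma_1,\Gamma_2)$, and let $G_j\le{\rm Aut}(\Gamma_j)$ be transitive on the darts of $\Gamma_j$ for $j\in\{1,2\}$. Let $G_1\times G_2$ act on the vertices of $\Gamma$ by $(a,x,i)^{(g_1,g_2)}=(a^{g_1},x^{g_2},i)$ and let $\sigma$ be the permutation $(a,x,i)^\sigma=(a^{\sigma_1},x^{\sigma_2},1-i)$. Then $\langle G_1\times G_2,\sigma\rangle$ acts vertex-transitively as a group of symmetries on the underlying graph $U\Gamma$ of $\Gamma$ and has two orbits on the darts and two orbits on the edges of $U\Gamma$, these being the sets of vertical and of horizontal darts (respectively edges) of $U\Gamma$. Moreover, if both $\Gamma_1$ and $\Gamma_2$ have valence at least $2$, then the stabiliser in $G_1\times G_2$ of a dart of $\Gamma$ is non-trivial.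
   Context: A digraph is a pair $({\mathcal V},{\mathcal D})$ with ${\mathcal V}$ a finite non-empty set and ${\mathcal D}$ a set of ordered pairs of distinct vertices (darts). A source (sink) is a vertex of in-valence (out-valence) $0$. The reverse of $\Gamma$ is $\Gamma^{ -1}=({\mathcal V},{\mathcal D}^{ -1})$ with ${\mathcal D}^{ -1}=\{(v,u):(u,v)\in{\mathcal D}\}$; a reversal is an isomorphism $\Gamma\to\Gamma^{ -1}$. The underlying graph of $\Gamma$ is $({\mathcal V},{\mathcal D}\cup{\mathcal D}^{ -1})$; its edges are the unordered pairs $\{u,v\}$ with $(u,v)$ or $(v,u)$ a dart. $\mathrm{SBP}(\Gamma_1,\Gamma_2)$ has vertex set ${\mathcal V}_1\times{\mathcal V}_2\times\mathbb Z_2$ and darts all $((a,x,0),(b,x,1))$ with $(a,b)\in{\mathcal D}_1$, $x\in{\mathcal V}_2$ (horizontal) and all $((a,x,1),(a,y,0))$ with $a\in{\mathcal V}_1$, $(x,y)\in{\mathcal D}_2$ (vertical); a dart or edge of the underlying graph is horizontal (vertical) if it comes from a horizontal (vertical) dart of $\mathrm{SBP}(\Gamma_1,\Gamma_2)$. -}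

module Defs where

open import Level using (0ℓ)
open import Data.Nat using (ℕ; NonZero)
open import Data.Fin using (Fin; zero; suc)
open import Data.Fin.Permutation using (Permutation′; _⟨$⟩ʳ_; id; flip; _∘ₚ_)
open import Data.Product using (Σ; ∃; ∃-syntax; _×_; _,_)
open import Data.Sum using (_⊎_)
open import Relation.Nullary using (¬_)
open import Relation.Binary.PropositionalEquality using (_≡_)

record Digraph : Set₁ where
  field
    order    : ℕ
    nonEmpty : NonZero order
    Dart     : Fin order → Fin order → Set
    loopless : ∀ v → ¬ Dart v v

open Digraph public

Vtx : Digraph → Set
Vtx Γ = Fin (order Γ)

NoSourcesNoSinks : Digraph → Set
NoSourcesNoSinks Γ = ∀ (v : Vtx Γ) → (∃[ w ] Dart Γ w v) × (∃[ w ] Dart Γ v w)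

-- valence at least 2 (out-valence; for the dart-transitive
-- digraphs without sources/sinks considered here in- and out-valence agree
-- and are constant)
ValenceAtLeast2 : Digraph → Set
ValenceAtLeast2 Γ = ∀ (v : Vtx Γ) →
  ∃[ w ] ∃[ w′ ] (Dart Γ v w × Dart Γ v w′ × ¬ (w ≡ w′))

IsAut : (Γ : Digraph) → Permutation′ (order Γ) → Set
IsAut Γ g = ∀ u v → (Dart Γ u v → Dart Γ (g ⟨$⟩ʳ u) (g ⟨$⟩ʳ v))
                  × (Dart Γ (g ⟨$⟩ʳ u) (g ⟨$⟩ʳ v) → Dart Γ u v)

IsReversal : (Γ : Digraph) → Permutation′ (order Γ) → Set
IsReversal Γ σ = ∀ u v → (Dart Γ u v → Dart Γ (σ ⟨$⟩ʳ v) (σ ⟨$⟩ʳ u))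
                       × (Dart Γ (σ ⟨$⟩ʳ v) (σ ⟨$⟩ʳ u) → Dart Γ u v)

record IsAutSubgroup (Γ : Digraph) (G : Permutation′ (order Γ) → Set) : Set where
  field
    idIn  : G id
    ∘In   : ∀ {g h} → G g → G h → G (g ∘ₚ h)
    invIn : ∀ {g} → G g → G (flip g)
    auts  : ∀ {g} → G g → IsAut Γ g

DartTransitive : (Γ : Digraph) → (Permutation′ (order Γ) → Set) → Set
DartTransitive Γ G = ∀ u v u′ v′ → Dart Γ u v → Dart Γ u′ v′ →
  ∃[ g ] (G g × g ⟨$⟩ʳ u ≡ u′ × g ⟨$⟩ʳ v ≡ v′)

module SBP (Γ₁ Γ₂ : Digraph) where

  V : Set
  V = Vtx Γ₁ × Vtx Γ₂ × Fin 2

  data HDart : V → V → Set where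
    hd : ∀ {a b x} → Dart Γ₁ a b → HDart (a , x , zero) (b , x , suc zero)

  data VDart : V → V → Set where
    vd : ∀ {a x y} → Dart Γ₂ x y → VDart (a , x , suc zero) (a , y , zero)

  SDart : V → V → Set
  SDart u v = HDart u v ⊎ VDart u v

  UDart : V → V → Set
  UDart u v = SDart u v ⊎ SDart v u

  UHor : V → V → Set
  UHor u v = HDart u v ⊎ HDart v u

  UVer : V → V → Set
  UVer u v = VDart u v ⊎ VDart v u

  prodAct : Permutation′ (order Γ₁) → Permutation′ (order Γ₂) → V → V
  prodAct g₁ g₂ (a , x , i) = (g₁ ⟨$⟩ʳ a , g₂ ⟨$⟩ʳ x , i)

  1-_ : Fin 2 → Fin 2
  1- zero = suc zero
  1- suc zero = zero

  sigmaAct : Permutation′ (order Γ₁) → Permutation′ (order Γ₂) → V → V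
  sigmaAct σ₁ σ₂ (a , x , i) = (σ₁ ⟨$⟩ʳ a , σ₂ ⟨$⟩ʳ x , 1- i)

  data Generated (G₁ : Permutation′ (order Γ₁) → Set)
                 (G₂ : Permutation′ (order Γ₂) → Set)
                 (σ₁ : Permutation′ (order Γ₁)) (σ₂ : Permutation′ (order Γ₂))
                 : (V → V) → Set where
    gId   : Generated G₁ G₂ σ₁ σ₂ (λ v → v)
    gProd : ∀ {g₁ g₂} → G₁ g₁ → G₂ g₂ → Generated G₁ G₂ σ₁ σ₂ (prodAct g₁ g₂)
    gSig  : Generated G₁ G₂ σ₁ σ₂ (sigmaAct σ₁ σ₂)
    gComp : ∀ {f h} → Generated G₁ G₂ σ₁ σ₂ f → Generated G₁ G₂ σ₁ σ₂ h →
            Generated G₁ G₂ σ₁ σ₂ (λ v → h (f v))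
    gInv  : ∀ {f f′} → Generated G₁ G₂ σ₁ σ₂ f →
            (∀ v → f′ (f v) ≡ v) → (∀ v → f (f′ v) ≡ v) →
            Generated G₁ G₂ σ₁ σ₂ f′

  IsUAut : (V → V) → Set
  IsUAut f = (Σ (V → V) λ f′ → ((∀ v → f′ (f v) ≡ v) × (∀ v → f (f′ v) ≡ v)))
           × (∀ u v → (UDart u v → UDart (f u) (f v)) × (UDart (f u) (f v) → UDart u v))

-- Elements of G₁ × G₂ fix the layer i and carry horizontal darts to
-- horizontal and vertical darts to vertical ones; σ swaps the layers and,
-- since σ₁ and σ₂ are reversals, turns each dart of Γ into a reversed dart
-- of the same kind.  Hence ⟨G₁ × G₂, σ⟩ acts on UΓ preserving the kind of
-- a dart.  Conversely, dart-transitivity of one factor together with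
-- vertex-transitivity of the other (a consequence of dart-transitivity in
-- the absence of sinks) makes G₁ × G₂ transitive on each kind of dart of Γ,
-- and σ supplies the opposite orientation.  If v has out-neighbours w ≠ w′,
-- an element of Gⱼ sending (v,w) to (v,w′) fixes v without being the
-- identity; paired with the identity of the other factor it fixes a dart.
module Submission where

open import Defs
open import Data.Fin using (zero; suc; fromℕ<)
open import Data.Fin.Permutation as Perm using (Permutation′; _⟨$⟩ʳ_; id; flip)
open import Data.Nat.Base using (>-nonZero⁻¹)
open import Data.Product as Product using (∃-syntax; _×_; _,_; proj₁; proj₂)
open import Data.Sum as Sum using (_⊎_; inj₁; inj₂)
open import Function using (_∘_)
open import Relation.Binary.Core using (_Preserves_⟶_)
open import Relation.Nullary using (¬_)
open import Relation.Binary.PropositionalEquality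
  using (_≡_; refl; sym; trans; cong; cong₂; subst₂)

Undirected : {A : Set} → (A → A → Set) → A → A → Set
Undirected R u v = R u v ⊎ R v u

module _ {A : Set} {R : A → A → Set} {f : A → A} where

  undirected-preserves : f Preserves R ⟶ R → f Preserves Undirected R ⟶ Undirected R
  undirected-preserves p (inj₁ r) = inj₁ (p r)
  undirected-preserves p (inj₂ r) = inj₂ (p r)

  undirected-reverses : (∀ {u v} → R u v → R (f v) (f u)) →
                        f Preserves Undirected R ⟶ Undirected R
  undirected-reverses p (inj₁ r) = inj₂ (p r)
  undirected-reverses p (inj₂ r) = inj₁ (p r)

someVertex : (Γ : Digraph) → Vtx Γ
someVertex Γ = fromℕ< (>-nonZero⁻¹ (order Γ) {{nonEmpty Γ}})

NoSinks : Digraph → Set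
NoSinks Γ = ∀ v → ∃[ w ] Dart Γ v w

Reverses : (Γ : Digraph) → Permutation′ (order Γ) → Set
Reverses Γ τ = ∀ {u v} → Dart Γ u v → Dart Γ (τ ⟨$⟩ʳ v) (τ ⟨$⟩ʳ u)

module _ (Γ : Digraph) where

  aut-preserves : ∀ g → IsAut Γ g → (g ⟨$⟩ʳ_) Preserves Dart Γ ⟶ Dart Γ
  aut-preserves g g-aut = proj₁ (g-aut _ _)

  reversal-reverses : ∀ τ → IsReversal Γ τ → Reverses Γ τ
  reversal-reverses τ τ-rev = proj₁ (τ-rev _ _)

  reversal⁻¹-reverses : ∀ τ → IsReversal Γ τ → Reverses Γ (flip τ)
  reversal⁻¹-reverses τ τ-rev d =
    proj₂ (τ-rev _ _) (subst₂ (Dart Γ) (sym (Perm.inverseʳ τ)) (sym (Perm.inverseʳ τ)) d)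

  some-dart : NoSinks Γ → ∃[ u ] ∃[ v ] Dart Γ u v
  some-dart out = someVertex Γ , out (someVertex Γ)

  module _ {G : Permutation′ (order Γ) → Set} (G-dart-transitive : DartTransitive Γ G) where

    vertex-transitive : NoSinks Γ → ∀ v v′ → ∃[ g ] (G g × g ⟨$⟩ʳ v ≡ v′)
    vertex-transitive out v v′ with out v | out v′
    ... | w , d | w′ , d′ with G-dart-transitive v w v′ w′ d d′
    ... | g , g∈G , gv≡v′ , _ = g , g∈G , gv≡v′

    nontrivial-vertex-stabiliser : ValenceAtLeast2 Γ →
      ∀ v → ∃[ g ] (G g × g ⟨$⟩ʳ v ≡ v × ¬ (∀ w → g ⟨$⟩ʳ w ≡ w))
    nontrivial-vertex-stabiliser valence v with valence v
    ... | w , w′ , d , d′ , w≢w′ with G-dart-transitive v w v w′ d d′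
    ... | g , g∈G , gv≡v , gw≡w′ =
      g , g∈G , gv≡v , λ g-fixes → w≢w′ (trans (sym (g-fixes w)) gw≡w′)

module Kinds (Γ₁ Γ₂ : Digraph) where
  open SBP Γ₁ Γ₂

  data Kind : Set where
    horizontal vertical : Kind

  Dartₖ : Kind → V → V → Set
  Dartₖ horizontal = HDart
  Dartₖ vertical   = VDart

  UDartₖ : Kind → V → V → Set
  UDartₖ k = Undirected (Dartₖ k)

  kind-of : ∀ {u v} → UDart u v → ∃[ k ] UDartₖ k u v
  kind-of (inj₁ (inj₁ h)) = horizontal , inj₁ h
  kind-of (inj₁ (inj₂ w)) = vertical   , inj₁ w
  kind-of (inj₂ (inj₁ h)) = horizontal , inj₂ h
  kind-of (inj₂ (inj₂ w)) = vertical   , inj₂ w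

  forget-kind : ∀ k {u v} → UDartₖ k u v → UDart u v
  forget-kind horizontal = Sum.map inj₁ inj₁
  forget-kind vertical   = Sum.map inj₂ inj₂

  SameKind : V → V → V → V → Set
  SameKind u v u′ v′ = (UHor u v × UHor u′ v′) ⊎ (UVer u v × UVer u′ v′)

  same-kind : ∀ k {u v u′ v′} → UDartₖ k u v → UDartₖ k u′ v′ → SameKind u v u′ v′
  same-kind horizontal e e′ = inj₁ (e , e′)
  same-kind vertical   e e′ = inj₂ (e , e′)

  same-kind-swapʳ : ∀ {u v u′ v′} → SameKind u v v′ u′ → SameKind u v u′ v′
  same-kind-swapʳ = Sum.map (Product.map₂ Sum.swap) (Product.map₂ Sum.swap)

  some-horizontal-dart : NoSinks Γ₁ → ∃[ u ] ∃[ v ] UHor u v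
  some-horizontal-dart out₁ =
    let _ , _ , d = some-dart Γ₁ out₁ in _ , _ , inj₁ (hd {x = someVertex Γ₂} d)

  some-vertical-dart : NoSinks Γ₂ → ∃[ u ] ∃[ v ] UVer u v
  some-vertical-dart out₂ =
    let _ , _ , d = some-dart Γ₂ out₂ in _ , _ , inj₁ (vd {a = someVertex Γ₁} d)

  PreservesKinds : (V → V) → Set
  PreservesKinds f = ∀ k → f Preserves UDartₖ k ⟶ UDartₖ k

  prodAct-preserves : ∀ g₁ g₂ → IsAut Γ₁ g₁ → IsAut Γ₂ g₂ → PreservesKinds (prodAct g₁ g₂)
  prodAct-preserves g₁ g₂ g₁-aut g₂-aut k =
    undirected-preserves {R = Dartₖ k} {f = prodAct g₁ g₂} (preserves k)
    where
    preserves : ∀ k → prodAct g₁ g₂ Preserves Dartₖ k ⟶ Dartₖ k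
    preserves horizontal (hd d) = hd (aut-preserves Γ₁ g₁ g₁-aut d)
    preserves vertical   (vd d) = vd (aut-preserves Γ₂ g₂ g₂-aut d)

  sigmaAct-reverses : ∀ τ₁ τ₂ → Reverses Γ₁ τ₁ → Reverses Γ₂ τ₂ →
    ∀ k {u v} → Dartₖ k u v → Dartₖ k (sigmaAct τ₁ τ₂ v) (sigmaAct τ₁ τ₂ u)
  sigmaAct-reverses τ₁ τ₂ τ₁-rev τ₂-rev horizontal (hd d) = hd (τ₁-rev d)
  sigmaAct-reverses τ₁ τ₂ τ₁-rev τ₂-rev vertical   (vd d) = vd (τ₂-rev d)

  sigmaAct-preserves : ∀ τ₁ τ₂ → Reverses Γ₁ τ₁ → Reverses Γ₂ τ₂ → PreservesKinds (sigmaAct τ₁ τ₂)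
  sigmaAct-preserves τ₁ τ₂ τ₁-rev τ₂-rev k =
    undirected-reverses {R = Dartₖ k} {f = sigmaAct τ₁ τ₂} (sigmaAct-reverses τ₁ τ₂ τ₁-rev τ₂-rev k)

  prodAct-inverse : ∀ g₁ g₂ v → prodAct (flip g₁) (flip g₂) (prodAct g₁ g₂ v) ≡ v
  prodAct-inverse g₁ g₂ v = cong₂ _,_ (Perm.inverseˡ g₁) (cong₂ _,_ (Perm.inverseˡ g₂) refl)

  1-involutive : ∀ i → 1- (1- i) ≡ i
  1-involutive zero       = refl
  1-involutive (suc zero) = refl

  sigmaAct-inverse : ∀ τ₁ τ₂ v → sigmaAct (flip τ₁) (flip τ₂) (sigmaAct τ₁ τ₂ v) ≡ v
  sigmaAct-inverse τ₁ τ₂ (a , x , i) =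
    cong₂ _,_ (Perm.inverseˡ τ₁) (cong₂ _,_ (Perm.inverseˡ τ₂) (1-involutive i))

  record KindSymmetry (f : V → V) : Set where
    field
      inverse           : V → V
      inverseˡ          : ∀ v → inverse (f v) ≡ v
      inverseʳ          : ∀ v → f (inverse v) ≡ v
      preserves         : PreservesKinds f
      inverse-preserves : PreservesKinds inverse

    reflects : ∀ k {u v} → UDartₖ k (f u) (f v) → UDartₖ k u v
    reflects k e = subst₂ (UDartₖ k) (inverseˡ _) (inverseˡ _) (inverse-preserves k e)

    isUAut : IsUAut f
    isUAut = (inverse , inverseˡ , inverseʳ) , λ u v → forward , backward
      where
      forward : ∀ {u v} → UDart u v → UDart (f u) (f v)
      forward d = let k , e = kind-of d in forget-kind k (preserves k e)
      backward : ∀ {u v} → UDart (f u) (f v) → UDart u v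
      backward d = let k , e = kind-of d in forget-kind k (reflects k e)

  open KindSymmetry

  preservesKinds-resp-≗ : ∀ {f g} → (∀ v → f v ≡ g v) → PreservesKinds f → PreservesKinds g
  preservesKinds-resp-≗ f≗g f-preserves k e = subst₂ (UDartₖ k) (f≗g _) (f≗g _) (f-preserves k e)

  identity-kindSymmetry : KindSymmetry (λ v → v)
  identity-kindSymmetry = record
    { inverse = λ v → v ; inverseˡ = λ _ → refl ; inverseʳ = λ _ → refl
    ; preserves = λ _ e → e ; inverse-preserves = λ _ e → e }

  ∘-kindSymmetry : ∀ {f h} → KindSymmetry f → KindSymmetry h → KindSymmetry (λ v → h (f v))
  ∘-kindSymmetry {f} {h} F H = record
    { inverse           = λ v → inverse F (inverse H v)
    ; inverseˡ          = λ v → trans (cong (inverse F) (inverseˡ H (f v))) (inverseˡ F v)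
    ; inverseʳ          = λ v → trans (cong h (inverseʳ F (inverse H v))) (inverseʳ H v)
    ; preserves         = λ k → preserves H k ∘ preserves F k
    ; inverse-preserves = λ k → inverse-preserves F k ∘ inverse-preserves H k }

  inverse-kindSymmetry : ∀ {f f′} → KindSymmetry f →
    (∀ v → f′ (f v) ≡ v) → (∀ v → f (f′ v) ≡ v) → KindSymmetry f′
  inverse-kindSymmetry {f} {f′} F f′∘f f∘f′ = record
    { inverse = f ; inverseˡ = f∘f′ ; inverseʳ = f′∘f
    ; preserves = preservesKinds-resp-≗ inverse≗f′ (inverse-preserves F)
    ; inverse-preserves = preserves F }
    where
    inverse≗f′ : ∀ v → inverse F v ≡ f′ v
    inverse≗f′ v = trans (sym (f′∘f (inverse F v))) (cong f′ (inverseʳ F v))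

  prodAct-kindSymmetry : ∀ g₁ g₂ → IsAut Γ₁ g₁ → IsAut Γ₂ g₂ →
    IsAut Γ₁ (flip g₁) → IsAut Γ₂ (flip g₂) → KindSymmetry (prodAct g₁ g₂)
  prodAct-kindSymmetry g₁ g₂ g₁-aut g₂-aut g₁⁻¹-aut g₂⁻¹-aut = record
    { inverse           = prodAct (flip g₁) (flip g₂)
    ; inverseˡ          = prodAct-inverse g₁ g₂
    ; inverseʳ          = prodAct-inverse (flip g₁) (flip g₂)
    ; preserves         = prodAct-preserves g₁ g₂ g₁-aut g₂-aut
    ; inverse-preserves = prodAct-preserves (flip g₁) (flip g₂) g₁⁻¹-aut g₂⁻¹-aut }

  sigmaAct-kindSymmetry : ∀ σ₁ σ₂ → IsReversal Γ₁ σ₁ → IsReversal Γ₂ σ₂ →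
    KindSymmetry (sigmaAct σ₁ σ₂)
  sigmaAct-kindSymmetry σ₁ σ₂ σ₁-rev σ₂-rev = record
    { inverse           = sigmaAct (flip σ₁) (flip σ₂)
    ; inverseˡ          = sigmaAct-inverse σ₁ σ₂
    ; inverseʳ          = sigmaAct-inverse (flip σ₁) (flip σ₂)
    ; preserves         = sigmaAct-preserves σ₁ σ₂
                            (reversal-reverses Γ₁ σ₁ σ₁-rev) (reversal-reverses Γ₂ σ₂ σ₂-rev)
    ; inverse-preserves = sigmaAct-preserves (flip σ₁) (flip σ₂)
                            (reversal⁻¹-reverses Γ₁ σ₁ σ₁-rev) (reversal⁻¹-reverses Γ₂ σ₂ σ₂-rev) }

module Generation
  (Γ₁ Γ₂ : Digraph)
  (σ₁ : Permutation′ (order Γ₁)) (σ₂ : Permutation′ (order Γ₂))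
  (G₁ : Permutation′ (order Γ₁) → Set) (G₂ : Permutation′ (order Γ₂) → Set)
  where
  open SBP Γ₁ Γ₂
  open Kinds Γ₁ Γ₂
  open IsAutSubgroup

  Gen : (V → V) → Set
  Gen = Generated G₁ G₂ σ₁ σ₂

  σ : V → V
  σ = sigmaAct σ₁ σ₂

  generated-kindSymmetry : IsAutSubgroup Γ₁ G₁ → IsAutSubgroup Γ₂ G₂ →
    IsReversal Γ₁ σ₁ → IsReversal Γ₂ σ₂ → ∀ {f} → Gen f → KindSymmetry f
  generated-kindSymmetry H₁ H₂ σ₁-rev σ₂-rev = go
    where
    go : ∀ {f} → Gen f → KindSymmetry f
    go gId                 = identity-kindSymmetry
    go (gProd {g₁} {g₂} g₁∈G g₂∈G) =
      prodAct-kindSymmetry g₁ g₂ (auts H₁ g₁∈G) (auts H₂ g₂∈G)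
                                 (auts H₁ (invIn H₁ g₁∈G)) (auts H₂ (invIn H₂ g₂∈G))
    go gSig                = sigmaAct-kindSymmetry σ₁ σ₂ σ₁-rev σ₂-rev
    go (gComp f∈ h∈)       = ∘-kindSymmetry (go f∈) (go h∈)
    go (gInv f∈ f′∘f f∘f′) = inverse-kindSymmetry (go f∈) f′∘f f∘f′

  SameOrbit : V → V → V → V → Set
  SameOrbit u v u′ v′ = ∃[ f ] (Gen f × f u ≡ u′ × f v ≡ v′)

  SameEdgeOrbit : V → V → V → V → Set
  SameEdgeOrbit u v u′ v′ = ∃[ f ] (Gen f × ((f u ≡ u′ × f v ≡ v′) ⊎ (f u ≡ v′ × f v ≡ u′)))

  sameOrbit-swap : ∀ {u v u′ v′} → SameOrbit v u v′ u′ → SameOrbit u v u′ v′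
  sameOrbit-swap (f , f∈ , fv , fu) = f , f∈ , fu , fv

  sameOrbit-via-σ : ∀ {u v u′ v′} → SameOrbit (σ u) (σ v) u′ v′ → SameOrbit u v u′ v′
  sameOrbit-via-σ (f , f∈ , fσu , fσv) = (λ w → f (σ w)) , gComp gSig f∈ , fσu , fσv

  kind-invariant : IsAutSubgroup Γ₁ G₁ → IsAutSubgroup Γ₂ G₂ →
    IsReversal Γ₁ σ₁ → IsReversal Γ₂ σ₂ →
    ∀ {u v u′ v′} → UDart u v → SameOrbit u v u′ v′ → SameKind u v u′ v′
  kind-invariant H₁ H₂ σ₁-rev σ₂-rev d (f , f∈ , fu , fv) =
    same-kind k e (subst₂ (UDartₖ k) fu fv (preserves F k e))
    where
    open KindSymmetry
    F = generated-kindSymmetry H₁ H₂ σ₁-rev σ₂-rev f∈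
    k = proj₁ (kind-of d)
    e = proj₂ (kind-of d)

  sameOrbit⇒sameEdgeOrbit : ∀ {u v u′ v′} → SameOrbit u v u′ v′ → SameEdgeOrbit u v u′ v′
  sameOrbit⇒sameEdgeOrbit (f , f∈ , fu , fv) = f , f∈ , inj₁ (fu , fv)

  edge-kind-invariant : IsAutSubgroup Γ₁ G₁ → IsAutSubgroup Γ₂ G₂ →
    IsReversal Γ₁ σ₁ → IsReversal Γ₂ σ₂ →
    ∀ {u v u′ v′} → UDart u v → SameEdgeOrbit u v u′ v′ → SameKind u v u′ v′
  edge-kind-invariant H₁ H₂ σ₁-rev σ₂-rev d (f , f∈ , inj₁ (fu , fv)) =
    kind-invariant H₁ H₂ σ₁-rev σ₂-rev d (f , f∈ , fu , fv)
  edge-kind-invariant H₁ H₂ σ₁-rev σ₂-rev d (f , f∈ , inj₂ (fu , fv)) =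
    same-kind-swapʳ (kind-invariant H₁ H₂ σ₁-rev σ₂-rev d (f , f∈ , fu , fv))

  module _ (out₁ : NoSinks Γ₁) (T₁ : DartTransitive Γ₁ G₁)
           (out₂ : NoSinks Γ₂) (T₂ : DartTransitive Γ₂ G₂) where

    layer-transitive : ∀ a x a′ x′ i → ∃[ f ] (Gen f × f (a , x , i) ≡ (a′ , x′ , i))
    layer-transitive a x a′ x′ i
      with vertex-transitive Γ₁ T₁ out₁ a a′ | vertex-transitive Γ₂ T₂ out₂ x x′
    ... | g₁ , g₁∈G , ga | g₂ , g₂∈G , gx =
      prodAct g₁ g₂ , gProd g₁∈G g₂∈G , cong₂ _,_ ga (cong₂ _,_ gx refl)

    cross-layer : ∀ a x i a′ x′ → ∃[ f ] (Gen f × f (a , x , i) ≡ (a′ , x′ , 1- i))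
    cross-layer a x i a′ x′ with layer-transitive (σ₁ ⟨$⟩ʳ a) (σ₂ ⟨$⟩ʳ x) a′ x′ (1- i)
    ... | f , f∈ , fσu = (λ w → f (σ w)) , gComp gSig f∈ , fσu

    generated-vertex-transitive : ∀ u w → ∃[ f ] (Gen f × f u ≡ w)
    generated-vertex-transitive (a , x , zero)     (a′ , x′ , zero)     = layer-transitive a x a′ x′ zero
    generated-vertex-transitive (a , x , suc zero) (a′ , x′ , suc zero) = layer-transitive a x a′ x′ (suc zero)
    generated-vertex-transitive (a , x , zero)     (a′ , x′ , suc zero) = cross-layer a x zero a′ x′
    generated-vertex-transitive (a , x , suc zero) (a′ , x′ , zero)     = cross-layer a x (suc zero) a′ x′

    dart-transitive : ∀ k {u v u′ v′} → Dartₖ k u v → Dartₖ k u′ v′ → SameOrbit u v u′ v′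
    dart-transitive horizontal (hd {a} {b} {x} d) (hd {a′} {b′} {x′} d′)
      with T₁ a b a′ b′ d d′ | vertex-transitive Γ₂ T₂ out₂ x x′
    ... | g₁ , g₁∈G , ga , gb | g₂ , g₂∈G , gx =
      prodAct g₁ g₂ , gProd g₁∈G g₂∈G ,
      cong₂ _,_ ga (cong₂ _,_ gx refl) , cong₂ _,_ gb (cong₂ _,_ gx refl)
    dart-transitive vertical (vd {a} {x} {y} d) (vd {a′} {x′} {y′} d′)
      with vertex-transitive Γ₁ T₁ out₁ a a′ | T₂ x y x′ y′ d d′
    ... | g₁ , g₁∈G , ga | g₂ , g₂∈G , gx , gy =
      prodAct g₁ g₂ , gProd g₁∈G g₂∈G ,
      cong₂ _,_ ga (cong₂ _,_ gx refl) , cong₂ _,_ ga (cong₂ _,_ gy refl)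

    undirected-dart-transitive : IsReversal Γ₁ σ₁ → IsReversal Γ₂ σ₂ →
      ∀ k {u v u′ v′} → UDartₖ k u v → UDartₖ k u′ v′ → SameOrbit u v u′ v′
    undirected-dart-transitive σ₁-rev σ₂-rev k = transitive
      where
      reverse : ∀ {u v} → Dartₖ k u v → Dartₖ k (σ v) (σ u)
      reverse = sigmaAct-reverses σ₁ σ₂
                  (reversal-reverses Γ₁ σ₁ σ₁-rev) (reversal-reverses Γ₂ σ₂ σ₂-rev) k
      transitive : ∀ {u v u′ v′} → UDartₖ k u v → UDartₖ k u′ v′ → SameOrbit u v u′ v′
      transitive (inj₁ d) (inj₁ d′) = dart-transitive k d d′
      transitive (inj₂ d) (inj₂ d′) = sameOrbit-swap (dart-transitive k d d′)
      transitive (inj₁ d) (inj₂ d′) = sameOrbit-via-σ (sameOrbit-swap (dart-transitive k (reverse d) d′))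
      transitive (inj₂ d) (inj₁ d′) = sameOrbit-via-σ (dart-transitive k (reverse d) d′)

    sameKind⇒sameOrbit : IsReversal Γ₁ σ₁ → IsReversal Γ₂ σ₂ →
      ∀ {u v u′ v′} → SameKind u v u′ v′ → SameOrbit u v u′ v′
    sameKind⇒sameOrbit σ₁-rev σ₂-rev (inj₁ (e , e′)) =
      undirected-dart-transitive σ₁-rev σ₂-rev horizontal e e′
    sameKind⇒sameOrbit σ₁-rev σ₂-rev (inj₂ (e , e′)) =
      undirected-dart-transitive σ₁-rev σ₂-rev vertical e e′

  dart-stabiliser-nontrivial : IsAutSubgroup Γ₁ G₁ → IsAutSubgroup Γ₂ G₂ →
    DartTransitive Γ₁ G₁ → DartTransitive Γ₂ G₂ →
    ValenceAtLeast2 Γ₁ → ValenceAtLeast2 Γ₂ →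
    ∀ u v → SDart u v →
    ∃[ g₁ ] ∃[ g₂ ] (G₁ g₁ × G₂ g₂
      × prodAct g₁ g₂ u ≡ u × prodAct g₁ g₂ v ≡ v
      × ¬ ((∀ a → g₁ ⟨$⟩ʳ a ≡ a) × (∀ x → g₂ ⟨$⟩ʳ x ≡ x)))
  dart-stabiliser-nontrivial H₁ H₂ T₁ T₂ val₁ val₂ _ _ (inj₁ (hd {a} {b} {x} _))
    with nontrivial-vertex-stabiliser Γ₂ T₂ val₂ x
  ... | g₂ , g₂∈G , gx , g₂≢id =
    id , g₂ , idIn H₁ , g₂∈G ,
    cong₂ _,_ refl (cong₂ _,_ gx refl) , cong₂ _,_ refl (cong₂ _,_ gx refl) , g₂≢id ∘ proj₂
  dart-stabiliser-nontrivial H₁ H₂ T₁ T₂ val₁ val₂ _ _ (inj₂ (vd {a} {x} {y} _))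
    with nontrivial-vertex-stabiliser Γ₁ T₁ val₁ a
  ... | g₁ , g₁∈G , ga , g₁≢id =
    g₁ , id , g₁∈G , idIn H₂ , cong₂ _,_ ga refl , cong₂ _,_ ga refl , g₁≢id ∘ proj₁

corollary3p2 : (Γ₁ Γ₂ : Digraph) →
    NoSourcesNoSinks Γ₁ → NoSourcesNoSinks Γ₂ →
    (σ₁ : Permutation′ (order Γ₁)) → IsReversal Γ₁ σ₁ →
    (σ₂ : Permutation′ (order Γ₂)) → IsReversal Γ₂ σ₂ →
    (G₁ : Permutation′ (order Γ₁) → Set) → IsAutSubgroup Γ₁ G₁ → DartTransitive Γ₁ G₁ →
    (G₂ : Permutation′ (order Γ₂) → Set) → IsAutSubgroup Γ₂ G₂ → DartTransitive Γ₂ G₂ →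
    let open SBP Γ₁ Γ₂ in
    let Gen = Generated G₁ G₂ σ₁ σ₂ in
    (∀ f → Gen f → IsUAut f)
    × (∀ (u w : V) → ∃[ f ] (Gen f × f u ≡ w))
    × (∃[ u ] ∃[ v ] UHor u v) × (∃[ u ] ∃[ v ] UVer u v)
    × (∀ u v u′ v′ → UDart u v → UDart u′ v′ →
    ((∃[ f ] (Gen f × f u ≡ u′ × f v ≡ v′))
    → ((UHor u v × UHor u′ v′) ⊎ (UVer u v × UVer u′ v′)))
    × (((UHor u v × UHor u′ v′) ⊎ (UVer u v × UVer u′ v′))
    → (∃[ f ] (Gen f × f u ≡ u′ × f v ≡ v′))))
    × (∀ u v u′ v′ → UDart u v → UDart u′ v′ →
    ((∃[ f ] (Gen f × ((f u ≡ u′ × f v ≡ v′) ⊎ (f u ≡ v′ × f v ≡ u′))))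
    → ((UHor u v × UHor u′ v′) ⊎ (UVer u v × UVer u′ v′)))
    × (((UHor u v × UHor u′ v′) ⊎ (UVer u v × UVer u′ v′))
    → (∃[ f ] (Gen f × ((f u ≡ u′ × f v ≡ v′) ⊎ (f u ≡ v′ × f v ≡ u′))))))
    × (ValenceAtLeast2 Γ₁ → ValenceAtLeast2 Γ₂ →
    ∀ u v → SDart u v →
    ∃[ g₁ ] ∃[ g₂ ] (G₁ g₁ × G₂ g₂
    × prodAct g₁ g₂ u ≡ u × prodAct g₁ g₂ v ≡ v
    × ¬ ((∀ a → g₁ ⟨$⟩ʳ a ≡ a) × (∀ x → g₂ ⟨$⟩ʳ x ≡ x))))
corollary3p2 Γ₁ Γ₂ ns₁ ns₂ σ₁ σ₁-rev σ₂ σ₂-rev G₁ H₁ T₁ G₂ H₂ T₂ =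
  (λ f f∈ → KindSymmetry.isUAut (generated-kindSymmetry H₁ H₂ σ₁-rev σ₂-rev f∈)) ,
  generated-vertex-transitive out₁ T₁ out₂ T₂ ,
  some-horizontal-dart out₁ ,
  some-vertical-dart out₂ ,
  (λ u v u′ v′ d _ → kind-invariant H₁ H₂ σ₁-rev σ₂-rev d , orbit) ,
  (λ u v u′ v′ d _ → edge-kind-invariant H₁ H₂ σ₁-rev σ₂-rev d , sameOrbit⇒sameEdgeOrbit ∘ orbit) ,
  dart-stabiliser-nontrivial H₁ H₂ T₁ T₂
  where
  open SBP Γ₁ Γ₂
  open Kinds Γ₁ Γ₂
  open Generation Γ₁ Γ₂ σ₁ σ₂ G₁ G₂
  out₁ : NoSinks Γ₁
  out₁ = proj₂ ∘ ns₁
  out₂ : NoSinks Γ₂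
  out₂ = proj₂ ∘ ns₂
  orbit : ∀ {u v u′ v′} → SameKind u v u′ v′ → SameOrbit u v u′ v′
  orbit = sameKind⇒sameOrbit out₁ T₁ out₂ T₂ σ₁-rev σ₂-rev
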